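{- Let $A=(A,0,1/2,\sqcup,\partial,\wedge)$ be an RM-algebra. For $a,b\in A$, define $a\sqsubseteq b$ iff $a\sqcup b=b$. Put $1=\partial(1/2,0)$, $\neg x=\partial(1/2,x)$ and $\nabla x=\partial(x,0)$. Then, for all $a,b,c\in A$: (i) $a\sqsubseteq b$ iff $\partial(a,0)\sqsubseteq b$ and $\partial(a,1)\sqsubseteq b$. (ii) If $c$ is Boolean, i.e. $c=\nabla c$, then $c\sqsubseteq b$ iff $\neg c\sqcup b=1/2$. (iii) $a\sqsubseteq b$ iff $\neg\partial(a,0)\sqcup b=1/2$ and $\neg\partial(a,1)\sqcup b=1/2$.
   Context: Let $\mathfrak Z=\{0,1/2,1\}$, with the following binary operations. - $x\wedge y=\min(x,y)$. - $x\sqcup y=x$ if $x=y$, and $x\sqcup y=1/2$ otherwise. - $\partial(x,y)=1/2$ if $y=1/2$. If $y\in\{0,1\}$, then $\partial(x,y)=y$ when $x=y$, and $\partial(x,y)=1-y$ when $x\ne y$. An RM-algebra is an algebra $(A,0,1/2,\sqcup,\partial,\wedge)$, with two constants and three binary operations, belonging to the variety generated by $(\mathfrak Z,0,1/2,\sqcup,\partial,\wedge)$. -}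

module Defs where

open import Data.Nat using (ℕ)
open import Relation.Binary.PropositionalEquality using (_≡_)

data Z3 : Set where
  z0 zh z1 : Z3

_∧ᶻ_ : Z3 → Z3 → Z3
z0 ∧ᶻ y  = z0
zh ∧ᶻ z0 = z0
zh ∧ᶻ zh = zh
zh ∧ᶻ z1 = zh
z1 ∧ᶻ y  = y

_⊔ᶻ_ : Z3 → Z3 → Z3
z0 ⊔ᶻ z0 = z0
zh ⊔ᶻ zh = zh
z1 ⊔ᶻ z1 = z1
_  ⊔ᶻ _  = zh

∂ᶻ : Z3 → Z3 → Z3
∂ᶻ _  zh = zh
∂ᶻ z0 z0 = z0
∂ᶻ zh z0 = z1
∂ᶻ z1 z0 = z1
∂ᶻ z0 z1 = z0
∂ᶻ zh z1 = z0
∂ᶻ z1 z1 = z1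

data Term : Set where
  var  : ℕ → Term
  c0   : Term
  chalf : Term
  _⊔ₜ_ : Term → Term → Term
  ∂ₜ   : Term → Term → Term
  _∧ₜ_ : Term → Term → Term

record RMSig : Set₁ where
  field
    Carrier : Set
    𝟘 : Carrier
    ½ : Carrier
    _⊔_ : Carrier → Carrier → Carrier
    ∂ : Carrier → Carrier → Carrier
    _∧_ : Carrier → Carrier → Carrier

eval : (S : RMSig) → Term → (ℕ → RMSig.Carrier S) → RMSig.Carrier S
eval S (var n) ρ = ρ n
eval S c0 ρ = RMSig.𝟘 S
eval S chalf ρ = RMSig.½ S
eval S (s ⊔ₜ t) ρ = RMSig._⊔_ S (eval S s ρ) (eval S t ρ)
eval S (∂ₜ s t) ρ = RMSig.∂ S (eval S s ρ) (eval S t ρ)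
eval S (s ∧ₜ t) ρ = RMSig._∧_ S (eval S s ρ) (eval S t ρ)

𝔷 : RMSig
𝔷 = record { Carrier = Z3 ; 𝟘 = z0 ; ½ = zh ; _⊔_ = _⊔ᶻ_ ; ∂ = ∂ᶻ ; _∧_ = _∧ᶻ_ }

Holds : RMSig → Term → Term → Set
Holds S s t = (ρ : ℕ → RMSig.Carrier S) → eval S s ρ ≡ eval S t ρ

-- RM-algebra: an algebra in the variety generated by 𝔷, i.e. (Birkhoff)
-- satisfying every identity that holds in 𝔷.
record RMAlgebra : Set₁ where
  field
    sig : RMSig
    identities : (s t : Term) → Holds 𝔷 s t → Holds sig s t
  open RMSig sig public

module RMOps (A : RMAlgebra) where
  open RMAlgebra A

  _⊑_ : Carrier → Carrier → Set
  a ⊑ b = (a ⊔ b) ≡ b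

  𝟙 : Carrier
  𝟙 = ∂ ½ 𝟘

  ¬' : Carrier → Carrier
  ¬' x = ∂ ½ x

  ∇ : Carrier → Carrier
  ∇ x = ∂ x 𝟘

-- Every law used below is an identity in at most three variables that holds in 𝔷; it is verified
-- there by exhaustive evaluation and hence holds in every RM-algebra. With these laws, ⊔ is a
-- semilattice whose order is ⊑, every a is the join ∂(a,0) ⊔ ∂(a,1) of two Boolean elements, and
-- for Boolean c the join c ⊔ b can be recovered from ¬c ⊔ b and b; when ¬c ⊔ b = 1/2 it is b.
module Submission where

open import Data.Nat.Base using (ℕ; zero; suc)
open import Data.Product.Base using (_×_; _,_)
open import Data.Product.Function.NonDependent.Propositional using (_×-⇔_)
open import Function.Bundles using (_⇔_; mk⇔)
open import Function.Construct.Composition using (_⇔-∘_)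
open import Relation.Binary.Definitions using (DecidableEquality)
open import Relation.Binary.PropositionalEquality
  using (_≡_; refl; sym; trans; cong; cong₂; subst; module ≡-Reasoning)
open import Relation.Nullary.Decidable using (Dec; yes; no; map′; _×-dec_; True; toWitness)

open import Defs

env₃ : {C : Set} → C → C → C → ℕ → C
env₃ a b c zero          = a
env₃ a b c (suc zero)    = b
env₃ a b c (suc (suc _)) = c

-- Identifies every variable beyond the third with the third, so that evaluating at ρ only
-- depends on ρ 0, ρ 1 and ρ 2.
collapse : Term → Term
collapse (var zero)          = var 0
collapse (var (suc zero))    = var 1
collapse (var (suc (suc _))) = var 2
collapse c0                  = c0
collapse chalf               = chalf
collapse (s ⊔ₜ t)            = collapse s ⊔ₜ collapse t
collapse (∂ₜ s t)            = ∂ₜ (collapse s) (collapse t)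
collapse (s ∧ₜ t)            = collapse s ∧ₜ collapse t

eval-collapse : (S : RMSig) (s : Term) (ρ : ℕ → RMSig.Carrier S) →
                eval S (collapse s) ρ ≡ eval S s (env₃ (ρ 0) (ρ 1) (ρ 2))
eval-collapse S (var zero)          ρ = refl
eval-collapse S (var (suc zero))    ρ = refl
eval-collapse S (var (suc (suc _))) ρ = refl
eval-collapse S c0                  ρ = refl
eval-collapse S chalf               ρ = refl
eval-collapse S (s ⊔ₜ t) ρ = cong₂ (RMSig._⊔_ S) (eval-collapse S s ρ) (eval-collapse S t ρ)
eval-collapse S (∂ₜ s t) ρ = cong₂ (RMSig.∂ S)   (eval-collapse S s ρ) (eval-collapse S t ρ)
eval-collapse S (s ∧ₜ t) ρ = cong₂ (RMSig._∧_ S) (eval-collapse S s ρ) (eval-collapse S t ρ)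

Identity₃ : RMSig → Term → Term → Set
Identity₃ S s t = (a b c : RMSig.Carrier S) → eval S s (env₃ a b c) ≡ eval S t (env₃ a b c)

identity₃⇒holds-collapse : {S : RMSig} (s t : Term) →
                           Identity₃ S s t → Holds S (collapse s) (collapse t)
identity₃⇒holds-collapse {S} s t h ρ =
  trans (eval-collapse S s ρ) (trans (h (ρ 0) (ρ 1) (ρ 2)) (sym (eval-collapse S t ρ)))

rm-identity₃ : (A : RMAlgebra) (s t : Term) → Identity₃ 𝔷 s t → Identity₃ (RMAlgebra.sig A) s t
rm-identity₃ A s t h a b c = begin
  eval sig s ρ               ≡⟨ sym (eval-collapse sig s ρ) ⟩
  eval sig (collapse s) ρ    ≡⟨ identities (collapse s) (collapse t)
                                           (identity₃⇒holds-collapse s t h) ρ ⟩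
  eval sig (collapse t) ρ    ≡⟨ eval-collapse sig t ρ ⟩
  eval sig t ρ               ∎
  where
  open RMAlgebra A
  open ≡-Reasoning
  ρ : ℕ → Carrier
  ρ = env₃ a b c

_≟ᶻ_ : DecidableEquality Z3
z0 ≟ᶻ z0 = yes refl
zh ≟ᶻ zh = yes refl
z1 ≟ᶻ z1 = yes refl
z0 ≟ᶻ zh = no λ ()
z0 ≟ᶻ z1 = no λ ()
zh ≟ᶻ z0 = no λ ()
zh ≟ᶻ z1 = no λ ()
z1 ≟ᶻ z0 = no λ ()
z1 ≟ᶻ zh = no λ ()

all-Z3? : {P : Z3 → Set} → ((a : Z3) → Dec (P a)) → Dec ((a : Z3) → P a)
all-Z3? P? = map′ (λ { (p₀ , pₕ , p₁) → λ { z0 → p₀ ; zh → pₕ ; z1 → p₁ } })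
                  (λ p → p z0 , p zh , p z1)
                  (P? z0 ×-dec P? zh ×-dec P? z1)

identity₃? : (s t : Term) → Dec (Identity₃ 𝔷 s t)
identity₃? s t = all-Z3? λ a → all-Z3? λ b → all-Z3? λ c →
  eval 𝔷 s (env₃ a b c) ≟ᶻ eval 𝔷 t (env₃ a b c)

module RMLaws (A : RMAlgebra) where
  open RMAlgebra A
  open RMOps A

  private
    x y z 𝟙ₜ : Term
    x  = var 0
    y  = var 1
    z  = var 2
    𝟙ₜ = ∂ₜ chalf c0

    by-𝔷 : (s t : Term) → {True (identity₃? s t)} → Identity₃ sig s t
    by-𝔷 s t {h} = rm-identity₃ A s t (toWitness h)

  ⊔-assoc : (a b c : Carrier) → (a ⊔ b) ⊔ c ≡ a ⊔ (b ⊔ c)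
  ⊔-assoc = by-𝔷 ((x ⊔ₜ y) ⊔ₜ z) (x ⊔ₜ (y ⊔ₜ z))

  ⊔-comm : (a b : Carrier) → a ⊔ b ≡ b ⊔ a
  ⊔-comm a b = by-𝔷 (x ⊔ₜ y) (y ⊔ₜ x) a b b

  ⊔-idem : (a : Carrier) → a ⊔ a ≡ a
  ⊔-idem a = by-𝔷 (x ⊔ₜ x) x a a a

  ⊔-zeroˡ : (b : Carrier) → ½ ⊔ b ≡ ½
  ⊔-zeroˡ b = by-𝔷 (chalf ⊔ₜ x) chalf b b b

  ¬-involutive : (b : Carrier) → ¬' (¬' b) ≡ b
  ¬-involutive b = by-𝔷 (∂ₜ chalf (∂ₜ chalf x)) x b b b

  ∂𝟘-⊔-∂𝟙 : (a : Carrier) → ∂ a 𝟘 ⊔ ∂ a 𝟙 ≡ a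
  ∂𝟘-⊔-∂𝟙 a = by-𝔷 (∂ₜ x c0 ⊔ₜ ∂ₜ x 𝟙ₜ) x a a a

  ∇-idem : (a : Carrier) → ∇ (∇ a) ≡ ∇ a
  ∇-idem a = by-𝔷 (∂ₜ (∂ₜ x c0) c0) (∂ₜ x c0) a a a

  ∇-∂𝟙 : (a : Carrier) → ∇ (∂ a 𝟙) ≡ ∂ a 𝟙
  ∇-∂𝟙 a = by-𝔷 (∂ₜ (∂ₜ x 𝟙ₜ) c0) (∂ₜ x 𝟙ₜ) a a a

  ¬∇-⊔-∇ : (a : Carrier) → ¬' (∇ a) ⊔ ∇ a ≡ ½
  ¬∇-⊔-∇ a = by-𝔷 (∂ₜ chalf (∂ₜ x c0) ⊔ₜ ∂ₜ x c0) chalf a a a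

  -- In 𝔷, with c = ∇ a: if ¬c ⊔ b = 1/2 the right-hand side is b ⊔ ¬¬b = b, and otherwise
  -- b = ¬c, so ∂(b, b) = b and the right-hand side is b ⊔ ¬b = 1/2 = c ⊔ b.
  ∇-⊔-via-¬ : (a b : Carrier) → ∇ a ⊔ b ≡ b ⊔ ¬' (∂ (¬' (∇ a) ⊔ b) b)
  ∇-⊔-via-¬ a b = by-𝔷 (∂ₜ x c0 ⊔ₜ y) (y ⊔ₜ ∂ₜ chalf (∂ₜ (∂ₜ chalf (∂ₜ x c0) ⊔ₜ y) y)) a b b

module RMOrder (A : RMAlgebra) where
  open RMAlgebra A
  open RMOps A
  open RMLaws A
  open ≡-Reasoning

  ⊑-trans : {a b c : Carrier} → a ⊑ b → b ⊑ c → a ⊑ c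
  ⊑-trans {a} {b} {c} a⊑b b⊑c = begin
    a ⊔ c         ≡⟨ cong (a ⊔_) (sym b⊑c) ⟩
    a ⊔ (b ⊔ c)   ≡⟨ sym (⊔-assoc a b c) ⟩
    (a ⊔ b) ⊔ c   ≡⟨ cong (_⊔ c) a⊑b ⟩
    b ⊔ c         ≡⟨ b⊑c ⟩
    c             ∎

  x⊑x⊔y : (a b : Carrier) → a ⊑ (a ⊔ b)
  x⊑x⊔y a b = trans (sym (⊔-assoc a a b)) (cong (_⊔ b) (⊔-idem a))

  y⊑x⊔y : (a b : Carrier) → b ⊑ (a ⊔ b)
  y⊑x⊔y a b = subst (b ⊑_) (⊔-comm b a) (x⊑x⊔y b a)

  ⊔-least : {a b c : Carrier} → a ⊑ c → b ⊑ c → (a ⊔ b) ⊑ c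
  ⊔-least {a} {b} {c} a⊑c b⊑c = trans (⊔-assoc a b c) (trans (cong (a ⊔_) b⊑c) a⊑c)

  ⊔-⊑⇔ : (a b c : Carrier) → ((a ⊔ b) ⊑ c) ⇔ ((a ⊑ c) × (b ⊑ c))
  ⊔-⊑⇔ a b c = mk⇔
    (λ a⊔b⊑c → ⊑-trans (x⊑x⊔y a b) a⊔b⊑c , ⊑-trans (y⊑x⊔y a b) a⊔b⊑c)
    (λ { (a⊑c , b⊑c) → ⊔-least a⊑c b⊑c })

  ⊑-∂-split : (a b : Carrier) → (a ⊑ b) ⇔ ((∂ a 𝟘 ⊑ b) × (∂ a 𝟙 ⊑ b))
  ⊑-∂-split a b = subst (λ u → (u ⊑ b) ⇔ ((∂ a 𝟘 ⊑ b) × (∂ a 𝟙 ⊑ b)))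
                        (∂𝟘-⊔-∂𝟙 a) (⊔-⊑⇔ (∂ a 𝟘) (∂ a 𝟙) b)

module RMBoolean (A : RMAlgebra) where
  open RMAlgebra A
  open RMOps A
  open RMLaws A
  open RMOrder A
  open ≡-Reasoning

  Boolean : Carrier → Set
  Boolean c = c ≡ ∇ c

  ∇-boolean : (a : Carrier) → Boolean (∇ a)
  ∇-boolean a = sym (∇-idem a)

  ∂𝟙-boolean : (a : Carrier) → Boolean (∂ a 𝟙)
  ∂𝟙-boolean a = sym (∇-∂𝟙 a)

  boolean-¬-⊔ : {c : Carrier} → Boolean c → ¬' c ⊔ c ≡ ½
  boolean-¬-⊔ {c} c-bool = subst (λ u → ¬' u ⊔ u ≡ ½) (sym c-bool) (¬∇-⊔-∇ c)

  boolean-⊔-via-¬ : {c : Carrier} → Boolean c → (b : Carrier) → c ⊔ b ≡ b ⊔ ¬' (∂ (¬' c ⊔ b) b)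
  boolean-⊔-via-¬ {c} c-bool b =
    subst (λ u → u ⊔ b ≡ b ⊔ ¬' (∂ (¬' u ⊔ b) b)) (sym c-bool) (∇-⊔-via-¬ c b)

  boolean-⊑⇔ : {c : Carrier} → Boolean c → (b : Carrier) → (c ⊑ b) ⇔ ((¬' c ⊔ b) ≡ ½)
  boolean-⊑⇔ {c} c-bool b = mk⇔ to from
    where
    to : c ⊑ b → ¬' c ⊔ b ≡ ½
    to c⊑b = begin
      ¬' c ⊔ b          ≡⟨ cong (¬' c ⊔_) (sym c⊑b) ⟩
      ¬' c ⊔ (c ⊔ b)    ≡⟨ sym (⊔-assoc (¬' c) c b) ⟩
      (¬' c ⊔ c) ⊔ b    ≡⟨ cong (_⊔ b) (boolean-¬-⊔ c-bool) ⟩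
      ½ ⊔ b             ≡⟨ ⊔-zeroˡ b ⟩
      ½                 ∎
    from : ¬' c ⊔ b ≡ ½ → c ⊑ b
    from ¬c⊔b≡½ = begin
      c ⊔ b                        ≡⟨ boolean-⊔-via-¬ c-bool b ⟩
      b ⊔ ¬' (∂ (¬' c ⊔ b) b)      ≡⟨ cong (λ u → b ⊔ ¬' (∂ u b)) ¬c⊔b≡½ ⟩
      b ⊔ ¬' (¬' b)                ≡⟨ cong (b ⊔_) (¬-involutive b) ⟩
      b ⊔ b                        ≡⟨ ⊔-idem b ⟩
      b                            ∎

  ⊑-¬-split : (a b : Carrier) →
              (a ⊑ b) ⇔ (((¬' (∂ a 𝟘) ⊔ b) ≡ ½) × ((¬' (∂ a 𝟙) ⊔ b) ≡ ½))
  ⊑-¬-split a b =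
    (boolean-⊑⇔ (∇-boolean a) b ×-⇔ boolean-⊑⇔ (∂𝟙-boolean a) b) ⇔-∘ ⊑-∂-split a b

proposition4p3 : (A : RMAlgebra) → let open RMAlgebra A in let open RMOps A in
    ((a b : Carrier) → (a ⊑ b) ⇔ ((∂ a 𝟘 ⊑ b) × (∂ a 𝟙 ⊑ b)))
    × ((b c : Carrier) → c ≡ ∇ c → (c ⊑ b) ⇔ ((¬' c ⊔ b) ≡ ½))
    × ((a b : Carrier) → (a ⊑ b) ⇔ (((¬' (∂ a 𝟘) ⊔ b) ≡ ½) × ((¬' (∂ a 𝟙) ⊔ b) ≡ ½)))
proposition4p3 A = ⊑-∂-split , (λ b c c-bool → boolean-⊑⇔ c-bool b) , ⊑-¬-split
  where
  open RMOrder A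
  open RMBoolean A
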